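{- Let $(a_N)_{N\ge1}$ be Stern's triatomic sequence. For any tuple $J=(j_1,\dots,j_n)$ with $j_i\in\{0,1,2\}$ ($n\ge0$), the sequence $$a_{\tau(J;1)},\ a_{\tau(J;2)},\ a_{\tau(J;3)},\ a_{\tau(J,1;3)},\ a_{\tau(J,1,1;3)},\ a_{\tau(J,1,1,1;3)},\ \dots$$ (where the terms after the third are $a_{\tau(J,1^s;3)}$, $s=1,2,3,\dots$, with $1^s$ denoting $s$ consecutive ones appended to $J$) is a tribonacci sequence, i.e. each term from the fourth on equals the sum of the three preceding terms.
   Context: Let $A_0=\begin{pmatrix}1&0&1\\0&1&1\\0&0&1\end{pmatrix}$, $A_1=\begin{pmatrix}0&0&1\\1&0&1\\0&1&1\end{pmatrix}$, $A_2=\begin{pmatrix}0&1&1\\0&0&1\\1&0&1\end{pmatrix}$. For a tuple $I=(i_1,\dots,i_n)$ with $i_j\in\{0,1,2\}$ ($n\ge0$) set $(v_1(I),v_2(I),v_3(I))=(1,1,1)A_{i_1}\cdots A_{i_n}$. Define $\tau(i_1,\dots,i_n;k)=\frac{3(3^n-1)}{2}+i_13^n+i_23^{n-1}+\cdots+i_n3+k$ for $k\in\{1,2,3\}$; every positive integer is $\tau(I;k)$ for exactly one pair $(I,k)$. Stern's triatomic sequence is $a_{\tau(I;k)}=v_k(I)$. -}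

module Defs where

open import Data.Nat using (ℕ; zero; suc; _+_; _*_; _∸_; _^_; _/_; _%_)
open import Data.Fin using (Fin; zero; suc; toℕ; fromℕ<)
open import Data.Fin as F using ()
open import Data.List using (List; []; _∷_; _++_; [_]; replicate; foldl)
open import Data.Product using (_×_; _,_; proj₁; proj₂)
open import Data.Nat.DivMod using (m%n<n)

V3 : Set
V3 = ℕ × ℕ × ℕ

-- Right multiplication of a row vector by A_0, A_1, A_2
mulA : V3 → Fin 3 → V3
-- A0 = [[1,0,1],[0,1,1],[0,0,1]]
mulA (x , y , z) zero = (x , y , x + y + z)
-- A1 = [[0,0,1],[1,0,1],[0,1,1]]
mulA (x , y , z) (suc zero) = (y , z , x + y + z)
-- A2 = [[0,1,1],[0,0,1],[1,0,1]]
mulA (x , y , z) (suc (suc zero)) = (z , x , x + y + z)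

v : List (Fin 3) → V3
v I = foldl mulA (1 , 1 , 1) I

vk : List (Fin 3) → Fin 3 → ℕ
vk I zero = proj₁ (v I)
vk I (suc zero) = proj₁ (proj₂ (v I))
vk I (suc (suc zero)) = proj₂ (proj₂ (v I))

val : List (Fin 3) → ℕ
val = foldl (λ acc i → 3 * acc + toℕ i) 0

len : List (Fin 3) → ℕ
len [] = 0
len (_ ∷ I) = suc (len I)

-- τ(I;k) for k ∈ {1,2,3}, encoded as k = suc (toℕ k') with k' : Fin 3.
-- τ(I;k) = 3(3^n-1)/2 + i1 3^n + ... + in 3 + k
τ : List (Fin 3) → Fin 3 → ℕ
τ I k = (3 * (3 ^ len I ∸ 1)) / 2 + 3 * val I + suc (toℕ k)

-- Decoding of a node index q of the ternary tree into a tuple: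
-- q = 0 ↦ (), q = 3q' + 1 + i ↦ decode(q') ++ (i).  Uses fuel for termination.
decodeNode : ℕ → ℕ → List (Fin 3)
decodeNode zero q = []
decodeNode (suc fuel) zero = []
decodeNode (suc fuel) (suc q) =
  decodeNode fuel (q / 3) ++ [ fromℕ< (m%n<n q 3) ]

-- Stern's triatomic sequence: a_N = v_k(I) where N = τ(I;k).
-- Write N - 1 = 3q + (k - 1); q encodes I. (a_0 is irrelevant; set to 0.)
a : ℕ → ℕ
a zero = 0
a (suc m) = vk (decodeNode (suc m) (m / 3)) (fromℕ< (m%n<n m 3))

-- The sequence a_{τ(J;1)}, a_{τ(J;2)}, a_{τ(J;3)}, a_{τ(J,1;3)}, a_{τ(J,1,1;3)}, ...
-- indexed from 0: term (2+s) is a_{τ(J,1^s;3)}.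
seqJ : List (Fin 3) → ℕ → ℕ
seqJ J 0 = a (τ J zero)
seqJ J 1 = a (τ J (suc zero))
seqJ J (suc (suc s)) = a (τ (J ++ replicate s (suc zero)) (suc (suc zero)))

private
  open import Relation.Binary.PropositionalEquality using (_≡_; refl)
  t1 : τ (suc zero ∷ zero ∷ []) (suc (suc zero)) ≡ 12 + 3 * 3 + 3
  t1 = refl
  t2 : a 20 ≡ vk (suc (suc zero) ∷ zero ∷ []) (suc zero)
  t2 = refl
  t3 : seqJ [] 5 ≡ 9
  t3 = refl
  t4 : seqJ (suc (suc zero) ∷ zero ∷ []) 6 ≡ seqJ (suc (suc zero) ∷ zero ∷ []) 3 + seqJ (suc (suc zero) ∷ zero ∷ []) 4 + seqJ (suc (suc zero) ∷ zero ∷ []) 5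
  t4 = refl
  t5 : a 1 ≡ 1
  t5 = refl
  t6 : a 4 ≡ 1
  t6 = refl
  t7 : a 6 ≡ 3
  t7 = refl

-- Number the nodes of the ternary tree breadth-first: the tuple I sits at index
-- (3^|I| − 1)/2 + (I read in base 3), and τ(I;k) = 3·index + k.  Hence the last
-- base-3 digit of N − 1 is k − 1 and the remaining digits recover I, so
-- a_{τ(I;k)} = v_k(I).
-- Appending a 1 to I multiplies v(I) by A₁, which sends (x, y, z) to
-- (y, z, x + y + z).  So v(J,1^s) is a window of three consecutive terms of the
-- sequence, and passing to v(J,1^(s+1)) shifts the window while producing their sum.
module Submission where

open import Defs
open import Data.Nat using (ℕ; _+_)
open import Data.Fin using (Fin)
open import Data.List using (List)
open import Relation.Binary.PropositionalEquality using (_≡_)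

open import Data.Nat using (zero; suc; _*_; _∸_; _/_; _%_; _^_; _<_; _≤_; s≤s)
open import Data.Nat.Properties using (+-comm; ≤-trans; m≤m*n; m≤n+m)
open import Data.Nat.DivMod using (m%n<n; m*n/n≡m; +-distrib-/-∣ʳ; m<n⇒m/n≡0; [m+kn]%n≡m%n; m<n⇒m%n≡m)
open import Data.Nat.Divisibility using (divides)
open import Data.Nat.Tactic.RingSolver using (solve-∀)
open import Data.Fin using (zero; suc; toℕ; fromℕ<)
open import Data.Fin.Properties using (toℕ-fromℕ<; toℕ-injective; toℕ<n)
open import Data.List using ([]; _∷_; _++_; [_]; _∷ʳ_; replicate; foldl)
open import Data.List.Properties using (foldl-++; foldl-∷ʳ; ++-identityʳ)
open import Data.List.Reverse using (Reverse; reverseView; []; _∶_∶ʳ_)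
open import Data.Product using (_,_)
open import Relation.Binary.PropositionalEquality using (refl; trans; cong; cong₂; module ≡-Reasoning)

repunit₃ : ℕ → ℕ
repunit₃ zero    = 0
repunit₃ (suc n) = 3 * repunit₃ n + 1

3^n≡1+2*repunit₃ : ∀ n → 3 ^ n ≡ suc (2 * repunit₃ n)
3^n≡1+2*repunit₃ zero    = refl
3^n≡1+2*repunit₃ (suc n) = trans (cong (3 *_) (3^n≡1+2*repunit₃ n)) (step (repunit₃ n))
  where
  step : ∀ r → 3 * suc (2 * r) ≡ suc (2 * (3 * r + 1))
  step = solve-∀

nodeIndex : List (Fin 3) → ℕ
nodeIndex I = repunit₃ (len I) + val I

len-∷ʳ : ∀ (I : List (Fin 3)) i → len (I ∷ʳ i) ≡ suc (len I)
len-∷ʳ []      i = refl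
len-∷ʳ (_ ∷ I) i = cong suc (len-∷ʳ I i)

nodeIndex-∷ʳ : ∀ I i → nodeIndex (I ∷ʳ i) ≡ suc (toℕ i + nodeIndex I * 3)
nodeIndex-∷ʳ I i = begin
  repunit₃ (len (I ∷ʳ i)) + val (I ∷ʳ i)
    ≡⟨ cong₂ _+_ (cong repunit₃ (len-∷ʳ I i)) (foldl-∷ʳ _ 0 i I) ⟩
  (3 * repunit₃ (len I) + 1) + (3 * val I + toℕ i)
    ≡⟨ regroup (repunit₃ (len I)) (val I) (toℕ i) ⟩
  suc (toℕ i + nodeIndex I * 3) ∎
  where
  open ≡-Reasoning
  regroup : ∀ r x d → 3 * r + 1 + (3 * x + d) ≡ suc (d + (r + x) * 3)
  regroup = solve-∀

τ≡suc[k+nodeIndex*3] : ∀ I k → τ I k ≡ suc (toℕ k + nodeIndex I * 3)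
τ≡suc[k+nodeIndex*3] I k = begin
  3 * (3 ^ len I ∸ 1) / 2 + 3 * val I + suc (toℕ k)
    ≡⟨ cong (λ t → 3 * (t ∸ 1) / 2 + 3 * val I + suc (toℕ k)) (3^n≡1+2*repunit₃ (len I)) ⟩
  3 * (2 * r) / 2 + 3 * val I + suc (toℕ k)
    ≡⟨ cong (λ t → t / 2 + 3 * val I + suc (toℕ k)) (halve r) ⟩
  3 * r * 2 / 2 + 3 * val I + suc (toℕ k)
    ≡⟨ cong (λ t → t + 3 * val I + suc (toℕ k)) (m*n/n≡m (3 * r) 2) ⟩
  3 * r + 3 * val I + suc (toℕ k)
    ≡⟨ regroup r (val I) (toℕ k) ⟩
  suc (toℕ k + nodeIndex I * 3) ∎
  where
  open ≡-Reasoning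
  r = repunit₃ (len I)
  halve : ∀ x → 3 * (2 * x) ≡ 3 * x * 2
  halve = solve-∀
  regroup : ∀ x y d → 3 * x + 3 * y + suc d ≡ suc (d + (x + y) * 3)
  regroup = solve-∀

n≤i+n*3 : ∀ n (i : Fin 3) → n ≤ toℕ i + n * 3
n≤i+n*3 n i = ≤-trans (m≤m*n n 3) (m≤n+m (n * 3) (toℕ i))

[i+n*3]/3≡n : ∀ n (i : Fin 3) → (toℕ i + n * 3) / 3 ≡ n
[i+n*3]/3≡n n i = begin
  (toℕ i + n * 3) / 3     ≡⟨ +-distrib-/-∣ʳ (toℕ i) (divides n refl) ⟩
  toℕ i / 3 + n * 3 / 3   ≡⟨ cong₂ _+_ (m<n⇒m/n≡0 (toℕ<n i)) (m*n/n≡m n 3) ⟩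
  n                       ∎
  where open ≡-Reasoning

[i+n*3]%3≡i : ∀ n (i : Fin 3) → fromℕ< (m%n<n (toℕ i + n * 3) 3) ≡ i
[i+n*3]%3≡i n i = toℕ-injective (begin
  toℕ (fromℕ< (m%n<n (toℕ i + n * 3) 3)) ≡⟨ toℕ-fromℕ< _ ⟩
  (toℕ i + n * 3) % 3                    ≡⟨ [m+kn]%n≡m%n (toℕ i) n 3 ⟩
  toℕ i % 3                              ≡⟨ m<n⇒m%n≡m (toℕ<n i) ⟩
  toℕ i                                  ∎)
  where open ≡-Reasoning

decodeNode-zero : ∀ fuel → decodeNode fuel 0 ≡ []
decodeNode-zero zero     = refl
decodeNode-zero (suc _)  = refl

decodeNode-nodeIndex : ∀ {I} → Reverse I → ∀ fuel → nodeIndex I < fuel → decodeNode fuel (nodeIndex I) ≡ I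
decodeNode-nodeIndex [] fuel _ = decodeNode-zero fuel
decodeNode-nodeIndex (I ∶ rI ∶ʳ i) fuel index<fuel
  rewrite nodeIndex-∷ʳ I i with fuel | index<fuel
... | suc fuel′ | s≤s m<fuel′ = cong₂ _++_
  (trans (cong (decodeNode fuel′) ([i+n*3]/3≡n (nodeIndex I) i))
         (decodeNode-nodeIndex rI fuel′ (≤-trans (s≤s (n≤i+n*3 (nodeIndex I) i)) m<fuel′)))
  (cong [_] ([i+n*3]%3≡i (nodeIndex I) i))

a-τ : ∀ I k → a (τ I k) ≡ vk I k
a-τ I k rewrite τ≡suc[k+nodeIndex*3] I k = cong₂ vk
  (trans (cong (decodeNode fuel) ([i+n*3]/3≡n (nodeIndex I) k))
         (decodeNode-nodeIndex (reverseView I) fuel (s≤s (n≤i+n*3 (nodeIndex I) k))))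
  ([i+n*3]%3≡i (nodeIndex I) k)
  where
  fuel : ℕ
  fuel = suc (toℕ k + nodeIndex I * 3)

foldl-replicate-suc : ∀ {ℓ₁ ℓ₂} {A : Set ℓ₁} {B : Set ℓ₂} (f : A → B → A) x y n →
                      foldl f x (replicate (suc n) y) ≡ f (foldl f x (replicate n y)) y
foldl-replicate-suc f x y zero    = refl
foldl-replicate-suc f x y (suc n) = foldl-replicate-suc f (f x y) y n

v-++-replicate-suc : ∀ J i n → v (J ++ replicate (suc n) i) ≡ mulA (v (J ++ replicate n i)) i
v-++-replicate-suc J i n = begin
  v (J ++ replicate (suc n) i)                        ≡⟨ foldl-++ mulA _ J (replicate (suc n) i) ⟩
  foldl mulA (v J) (replicate (suc n) i)              ≡⟨ foldl-replicate-suc mulA (v J) i n ⟩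
  mulA (foldl mulA (v J) (replicate n i)) i           ≡⟨ cong (λ w → mulA w i) (foldl-++ mulA _ J (replicate n i)) ⟨
  mulA (v (J ++ replicate n i)) i                     ∎
  where open ≡-Reasoning

seqJ-window : ∀ J s → v (J ++ replicate s (suc zero)) ≡ (seqJ J s , seqJ J (suc s) , seqJ J (suc (suc s)))
seqJ-window J zero
  rewrite a-τ J zero | a-τ J (suc zero) | a-τ (J ++ []) (suc (suc zero)) | ++-identityʳ J = refl
seqJ-window J (suc s)
  rewrite a-τ (J ++ replicate (suc s) (suc zero)) (suc (suc zero))
        | v-++-replicate-suc J (suc zero) s
        | seqJ-window J s = refl

mainTheorem4 : (J : List (Fin 3)) → (m : ℕ) →
    seqJ J (m + 3) ≡ seqJ J m + seqJ J (m + 1) + seqJ J (m + 2)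
mainTheorem4 J m = begin
  seqJ J (m + 3)                                       ≡⟨ cong (seqJ J) (+-comm m 3) ⟩
  seqJ J (3 + m)                                       ≡⟨ a-τ (J ++ replicate (suc m) one) (suc (suc zero)) ⟩
  third (v (J ++ replicate (suc m) one))               ≡⟨ cong third (v-++-replicate-suc J one m) ⟩
  third (mulA (v (J ++ replicate m one)) one)          ≡⟨ cong (λ w → third (mulA w one)) (seqJ-window J m) ⟩
  seqJ J m + seqJ J (1 + m) + seqJ J (2 + m)           ≡⟨ cong₂ (λ p q → seqJ J m + seqJ J p + seqJ J q) (+-comm 1 m) (+-comm 2 m) ⟩
  seqJ J m + seqJ J (m + 1) + seqJ J (m + 2)           ∎
  where
  open ≡-Reasoning
  one : Fin 3
  one = suc zero
  third : V3 → ℕ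
  third (_ , _ , z) = z
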